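{- Define three classes of frames: - $\mathcal{C}^{\mathbf{pre}}_{\mathbf{ud}}$ is the class of all prestandard frames that are up and down reflexive and up and down symmetric; - $\mathcal{C}^{\mathbf{pre}}_{\mathbf{rs}}$ is the class of all prestandard frames in which every $R(\alpha)$ is reflexive and symmetric; - $\mathcal{C}^{\mathbf{pre}}_{\mathbf{par}}$ is the class of all prestandard frames in which every $R(\alpha)$ is reflexive, symmetric and transitive. Then $\mathtt{Log}(\mathcal{C}^{\mathbf{pre}}_{\mathbf{ud}})=\mathtt{Log}(\mathcal{C}^{\mathbf{pre}}_{\mathbf{rs}})=\mathtt{Log}(\mathcal{C}^{\mathbf{pre}}_{\mathbf{par}})$. Here: - a frame is prestandard if $R(\alpha\cup\beta)\subseteq R(\alpha)\cap R(\beta)$ for all groups $\alpha,\beta$; - it is up and down reflexive if for every group $\alpha$ and every $s$, $s\,(\leq\circ R(\alpha)\circ\leq)\,s$ and $s\,(\geq\circ R(\alpha)\circ\geq)\,s$; - it is up and down symmetric if for every group $\alpha$ and all $s,t$, $sR(\alpha)t$ implies $t\,(\leq\circ R(\alpha)\circ\leq)\,s$ and $t\,(\geq\circ R(\alpha)\circ\geq)\,s$.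
   Context: **Language.** Let $\mathbf{At}$ be a countably infinite set of atoms and let $\mathbf{Ag}$ be a finite set of agents. A group is a nonempty subset of $\mathbf{Ag}$. Formulas are generated by $$A ::= p \mid (A\rightarrow A) \mid \top \mid \bot \mid (A\vee A) \mid (A\wedge A) \mid [\alpha]A \mid \langle\alpha\rangle A.$$ **Frames.** A frame is a triple $(W,\leq,R)$ where $W$ is a nonempty set, $\leq$ is a preorder on $W$, and $R$ assigns to each group $\alpha$ a binary relation $R(\alpha)$ on $W$. For binary relations $S,T$, write $s\,(S\circ T)\,t$ iff there is $u$ with $sSu$ and $uTt$. Write $\geq$ for the converse of $\leq$. **Models and satisfaction.** A valuation is a map $V:\mathbf{At}\to\wp(W)$ with each $V(p)$ upward closed under $\leq$. Satisfaction in a model $(W,\leq,R,V)$ is defined as follows: - $s\models p$ iff $s\in V(p)$; - $s\models A\rightarrow B$ iff for all $t\geq s$, either $t\not\models A$ or $t\models B$; - $s\models\top$, and $s\not\models\bot$; - $\vee$ and $\wedge$ are interpreted pointwise; - $s\models[\alpha]A$ iff for all $t$ with $s\,(\leq\circ R(\alpha))\,t$, $t\models A$; - $s\models\langle\alpha\rangle A$ iff there is $t$ with $s\,(\geq\circ R(\alpha))\,t$ and $t\models A$. A formula is valid in a frame if it is satisfied at every state of every model based on that frame. For a class $\mathcal{C}$ of frames, $\mathtt{Log}(\mathcal{C})$ is the set of formulas valid in every frame in $\mathcal{C}$. -}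

module Defs where

open import Data.Nat using (ℕ)
open import Data.Fin.Subset using (Subset; Nonempty; _∪_)
open import Data.Fin.Subset.Properties using (nonempty?; p⊆p∪q)
open import Data.Product using (Σ; ∃; ∃-syntax; _×_; _,_; proj₁)
open import Data.Sum using (_⊎_)
open import Data.Empty renaming (⊥ to Empty)
open import Data.Unit renaming (⊤ to Unit)
open import Relation.Nullary.Decidable using (True; toWitness; fromWitness)

-- Agents: Ag = Fin n.  A group is a nonempty subset of Ag.
-- Nonemptiness is recorded as a proof-irrelevant 'True (nonempty? s)',
-- so a group is determined by its underlying subset.
record Group (n : ℕ) : Set where
  constructor group
  field
    members  : Subset n
    nonempty : True (nonempty? members)
open Group public

_∪ᴳ_ : ∀ {n} → Group n → Group n → Group n
group a pa ∪ᴳ group b pb = group (a ∪ b)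
  (fromWitness (let (x , x∈a) = toWitness pa in x , p⊆p∪q b x∈a))

data Form (n : ℕ) : Set where
  atom : ℕ → Form n
  _⇒_  : Form n → Form n → Form n
  ⊤′ ⊥′ : Form n
  _∨′_ _∧′_ : Form n → Form n → Form n
  box dia : Group n → Form n → Form n

Rel : Set → Set₁
Rel W = W → W → Set

record Frame (n : ℕ) : Set₁ where
  field
    W      : Set
    point  : W
    _≤_    : Rel W
    ≤-refl : ∀ {s} → s ≤ s
    ≤-trans : ∀ {s t u} → s ≤ t → t ≤ u → s ≤ u
    R      : Group n → Rel W

module _ {n : ℕ} (F : Frame n) where
  open Frame F

  record Valuation : Set₁ where
    field
      V      : ℕ → W → Set
      upward : ∀ p {s t} → s ≤ t → V p s → V p t

  LRL : Group n → Rel W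
  LRL α s t = ∃[ u ] ∃[ v ] (s ≤ u × R α u v × v ≤ t)

  GRG : Group n → Rel W
  GRG α s t = ∃[ u ] ∃[ v ] (u ≤ s × R α u v × t ≤ v)

  Prestandard : Set
  Prestandard = ∀ α β {s t} → R (α ∪ᴳ β) s t → R α s t × R β s t

  UpDownReflexive : Set
  UpDownReflexive = ∀ α s → LRL α s s × GRG α s s

  UpDownSymmetric : Set
  UpDownSymmetric = ∀ α {s t} → R α s t → LRL α t s × GRG α t s

  Reflexive Symmetric Transitive : Set
  Reflexive  = ∀ α {s} → R α s s
  Symmetric  = ∀ α {s t} → R α s t → R α t s
  Transitive = ∀ α {s t u} → R α s t → R α t u → R α s u

  Sat : Valuation → W → Form n → Set
  Sat 𝓥 s (atom p) = Valuation.V 𝓥 p s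
  Sat 𝓥 s (A ⇒ B) = ∀ t → s ≤ t → Sat 𝓥 t A → Sat 𝓥 t B
  Sat 𝓥 s ⊤′ = Unit
  Sat 𝓥 s ⊥′ = Empty
  Sat 𝓥 s (A ∨′ B) = Sat 𝓥 s A ⊎ Sat 𝓥 s B
  Sat 𝓥 s (A ∧′ B) = Sat 𝓥 s A × Sat 𝓥 s B
  Sat 𝓥 s (box α A) = ∀ u t → s ≤ u → R α u t → Sat 𝓥 t A
  Sat 𝓥 s (dia α A) = ∃[ u ] ∃[ t ] (u ≤ s × R α u t × Sat 𝓥 t A)

  ValidInFrame : Form n → Set₁
  ValidInFrame A = ∀ (𝓥 : Valuation) (s : W) → Sat 𝓥 s A

FrameClass : ℕ → Set₁
FrameClass n = Frame n → Set

InLog : ∀ {n} → FrameClass n → Form n → Set₁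
InLog 𝒞 A = ∀ F → 𝒞 F → ValidInFrame F A

C-ud C-rs C-par : ∀ {n} → FrameClass n
C-ud  F = Prestandard F × UpDownReflexive F × UpDownSymmetric F
C-rs  F = Prestandard F × Reflexive F × Symmetric F
C-par F = Prestandard F × Reflexive F × Symmetric F × Transitive F

SameLog : ∀ {n} → FrameClass n → FrameClass n → Set₁
SameLog 𝒞 𝒟 = ∀ A → (InLog 𝒞 A → InLog 𝒟 A) × (InLog 𝒟 A → InLog 𝒞 A)

-- Both nontrivial inclusions of logics come from surjective "reductions" of frames,
-- which preserve the truth of every formula and hence reflect validity.  An
-- up-and-down reflexive and symmetric frame is the image, under the identity, of the
-- frame with each R α replaced by its reflexive–symmetric closure: a closure step is always simulated by a
-- ≤∘R∘≤ or ≥∘R∘≥ path, and persistence absorbs the order steps.  A reflexive and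
-- symmetric frame is the image, under the first projection, of a frame on pairs in
-- which (s , t) is related to itself and to (t , s) whenever s R t; that relation is
-- an equivalence.
module Submission where

open import Defs
open import Data.Nat using (ℕ)
open import Data.Product using (_×_; _,_; proj₁; proj₂; ∃-syntax)
open import Data.Sum using (inj₁; inj₂)
open import Function using (id)
open import Relation.Binary.PropositionalEquality using (_≡_; refl; subst; sym)
open import Relation.Binary.Construct.Closure.Reflexive as Refl using (ReflClosure; [_])
open import Relation.Binary.Construct.Closure.Reflexive.Properties as Reflₚ using ()
open import Relation.Binary.Construct.Closure.Symmetric as Sym using (SymClosure; fwd; bwd)

module _ {n : ℕ} (F : Frame n) where
  open Frame F

  Sat-persistent : ∀ 𝓥 A {s t} → s ≤ t → Sat F 𝓥 s A → Sat F 𝓥 t A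
  Sat-persistent 𝓥 (atom p) s≤t = Valuation.upward 𝓥 p s≤t
  Sat-persistent 𝓥 (A ⇒ B) s≤t h u t≤u = h u (≤-trans s≤t t≤u)
  Sat-persistent 𝓥 ⊤′ s≤t h = h
  Sat-persistent 𝓥 (A ∨′ B) s≤t (inj₁ a) = inj₁ (Sat-persistent 𝓥 A s≤t a)
  Sat-persistent 𝓥 (A ∨′ B) s≤t (inj₂ b) = inj₂ (Sat-persistent 𝓥 B s≤t b)
  Sat-persistent 𝓥 (A ∧′ B) s≤t (a , b) = Sat-persistent 𝓥 A s≤t a , Sat-persistent 𝓥 B s≤t b
  Sat-persistent 𝓥 (box α A) s≤t h u v t≤u = h u v (≤-trans s≤t t≤u)
  Sat-persistent 𝓥 (dia α A) s≤t (u , v , u≤s , r , a) = u , v , ≤-trans u≤s s≤t , r , a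

  R⊆LRL×GRG : ∀ α {s t} → R α s t → LRL F α s t × GRG F α s t
  R⊆LRL×GRG α r = (_ , _ , ≤-refl , r , ≤-refl) , (_ , _ , ≤-refl , r , ≤-refl)

-- A surjective bounded morphism from G onto F, with the zig-zag conditions taken up to ≤.
record Reduction {n : ℕ} (G F : Frame n) : Set₁ where
  private
    module G = Frame G
    module F = Frame F
  field
    map         : G.W → F.W
    section     : F.W → G.W
    map-section : ∀ x → map (section x) ≡ x
    map-mono    : ∀ {s t} → s G.≤ t → map s F.≤ map t
    map-reflect : ∀ {s t} → map s F.≤ map t → s G.≤ t
    forth       : ∀ α {s t} → G.R α s t → LRL F α (map s) (map t) × GRG F α (map s) (map t)
    back-box    : ∀ α {s a b} → map s F.≤ a → F.R α a b →
                  ∃[ u ] ∃[ t ] (s G.≤ u × G.R α u t × map t F.≤ b)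
    back-dia    : ∀ α {s a b} → a F.≤ map s → F.R α a b →
                  ∃[ u ] ∃[ t ] (u G.≤ s × G.R α u t × b F.≤ map t)

  pullback : Valuation F → Valuation G
  pullback 𝓥 = record
    { V      = λ p s → Valuation.V 𝓥 p (map s)
    ; upward = λ p s≤t → Valuation.upward 𝓥 p (map-mono s≤t)
    }

  module _ (𝓥 : Valuation F) where
    Sat-section : ∀ A x → Sat F 𝓥 (map (section x)) A → Sat F 𝓥 x A
    Sat-section A x = subst (λ y → Sat F 𝓥 y A) (map-section x)

    Sat-unsection : ∀ A x → Sat F 𝓥 x A → Sat F 𝓥 (map (section x)) A
    Sat-unsection A x = subst (λ y → Sat F 𝓥 y A) (sym (map-section x))

    Sat-map : ∀ A s → Sat G (pullback 𝓥) s A → Sat F 𝓥 (map s) A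
    Sat-comap : ∀ A s → Sat F 𝓥 (map s) A → Sat G (pullback 𝓥) s A

    Sat-map (atom p) s h = h
    Sat-map (A ⇒ B) s h x s≤x a = Sat-section B x
      (Sat-map B (section x)
        (h (section x) (map-reflect (subst (map s F.≤_) (sym (map-section x)) s≤x))
           (Sat-comap A (section x) (Sat-unsection A x a))))
    Sat-map ⊤′ s h = h
    Sat-map (A ∨′ B) s (inj₁ a) = inj₁ (Sat-map A s a)
    Sat-map (A ∨′ B) s (inj₂ b) = inj₂ (Sat-map B s b)
    Sat-map (A ∧′ B) s (a , b) = Sat-map A s a , Sat-map B s b
    Sat-map (box α A) s h a b s≤a r with back-box α s≤a r
    ... | u , t , s≤u , r′ , t≤b = Sat-persistent F 𝓥 A t≤b (Sat-map A t (h u t s≤u r′))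
    Sat-map (dia α A) s (u , t , u≤s , r , h) with proj₂ (forth α r)
    ... | a , b , a≤u , r′ , t≤b =
      a , b , F.≤-trans a≤u (map-mono u≤s) , r′ , Sat-persistent F 𝓥 A t≤b (Sat-map A t h)

    Sat-comap (atom p) s h = h
    Sat-comap (A ⇒ B) s h t s≤t a = Sat-comap B t (h (map t) (map-mono s≤t) (Sat-map A t a))
    Sat-comap ⊤′ s h = h
    Sat-comap (A ∨′ B) s (inj₁ a) = inj₁ (Sat-comap A s a)
    Sat-comap (A ∨′ B) s (inj₂ b) = inj₂ (Sat-comap B s b)
    Sat-comap (A ∧′ B) s (a , b) = Sat-comap A s a , Sat-comap B s b
    Sat-comap (box α A) s h u t s≤u r with proj₁ (forth α r)
    ... | a , b , u≤a , r′ , b≤t =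
      Sat-comap A t (Sat-persistent F 𝓥 A b≤t (h a b (F.≤-trans (map-mono s≤u) u≤a) r′))
    Sat-comap (dia α A) s (a , b , a≤s , r , h) with back-dia α a≤s r
    ... | u , t , u≤s , r′ , b≤t = u , t , u≤s , r′ , Sat-comap A t (Sat-persistent F 𝓥 A b≤t h)

  valid-reflect : ∀ A → ValidInFrame G A → ValidInFrame F A
  valid-reflect A valid 𝓥 x = Sat-section 𝓥 A x (Sat-map 𝓥 A (section x) (valid (pullback 𝓥) (section x)))

InLog-antitone : ∀ {n} {𝒞 𝒟 : FrameClass n} → (∀ F → 𝒞 F → 𝒟 F) → ∀ A → InLog 𝒟 A → InLog 𝒞 A
InLog-antitone 𝒞⊆𝒟 A valid F F∈𝒞 = valid F (𝒞⊆𝒟 F F∈𝒞)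

InLog-reduction : ∀ {n} {𝒞 𝒟 : FrameClass n} →
                  (∀ F → 𝒞 F → ∃[ G ] (𝒟 G × Reduction G F)) → ∀ A → InLog 𝒟 A → InLog 𝒞 A
InLog-reduction reduce A valid F F∈𝒞 with reduce F F∈𝒞
... | G , G∈𝒟 , ρ = Reduction.valid-reflect ρ A (valid G G∈𝒟)

C-par⊆C-rs : ∀ {n} (F : Frame n) → C-par F → C-rs F
C-par⊆C-rs F (pre , rfl , symm , _) = pre , rfl , symm

C-rs⊆C-ud : ∀ {n} (F : Frame n) → C-rs F → C-ud F
C-rs⊆C-ud F (pre , rfl , symm) =
  pre , (λ α s → R⊆LRL×GRG F α (rfl α)) , (λ α r → R⊆LRL×GRG F α (symm α r))

module RSClosure {n : ℕ} (F : Frame n) where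
  open Frame F

  RS : Group n → Rel W
  RS α = ReflClosure (SymClosure (R α))

  frame : Frame n
  frame = record { W = W ; point = point ; _≤_ = _≤_ ; ≤-refl = ≤-refl ; ≤-trans = ≤-trans ; R = RS }

  C-rs-frame : Prestandard F → C-rs frame
  C-rs-frame pre =
    (λ α β r → Refl.map (Sym.map (λ r′ → proj₁ (pre α β r′))) r
             , Refl.map (Sym.map (λ r′ → proj₂ (pre α β r′))) r)
    , (λ α → ReflClosure.refl)
    , (λ α → Reflₚ.sym (Sym.symmetric (R α)))

  RS⊆LRL×GRG : UpDownReflexive F → UpDownSymmetric F →
               ∀ α {s t} → RS α s t → LRL F α s t × GRG F α s t
  RS⊆LRL×GRG udr uds α ReflClosure.refl = udr α _
  RS⊆LRL×GRG udr uds α [ fwd r ] = R⊆LRL×GRG F α r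
  RS⊆LRL×GRG udr uds α [ bwd r ] = uds α r

  reduction : UpDownReflexive F → UpDownSymmetric F → Reduction frame F
  reduction udr uds = record
    { map         = id
    ; section     = id
    ; map-section = λ _ → refl
    ; map-mono    = id
    ; map-reflect = id
    ; forth       = RS⊆LRL×GRG udr uds
    ; back-box    = λ α {_} {a} {b} s≤a r → a , b , s≤a , [ fwd r ] , ≤-refl
    ; back-dia    = λ α {_} {a} {b} a≤s r → a , b , a≤s , [ fwd r ] , ≤-refl
    }

module PairFrame {n : ℕ} (F : Frame n) where
  open Frame F

  data Swap (α : Group n) : Rel (W × W) where
    stay : ∀ {p} → Swap α p p
    swap : ∀ {s t} → R α s t → Swap α (s , t) (t , s)

  frame : Frame n
  frame = record
    { W = W × W ; point = point , point ; _≤_ = λ p q → proj₁ p ≤ proj₁ q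
    ; ≤-refl = ≤-refl ; ≤-trans = ≤-trans ; R = Swap }

  Swap-trans : Transitive frame
  Swap-trans α stay q = q
  Swap-trans α (swap r) stay = swap r
  Swap-trans α (swap r) (swap r′) = stay

  C-par-frame : C-rs F → C-par frame
  C-par-frame (pre , rfl , symm) =
    (λ { α β stay → stay , stay
       ; α β (swap r) → swap (proj₁ (pre α β r)) , swap (proj₂ (pre α β r)) })
    , (λ α → stay)
    , (λ { α stay → stay ; α (swap r) → swap (symm α r) })
    , Swap-trans

  Swap⇒R : Reflexive F → ∀ α {p q} → Swap α p q → R α (proj₁ p) (proj₁ q)
  Swap⇒R rfl α stay = rfl α
  Swap⇒R rfl α (swap r) = r

  reduction : Reflexive F → Reduction frame F
  reduction rfl = record
    { map         = proj₁
    ; section     = λ x → x , x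
    ; map-section = λ _ → refl
    ; map-mono    = id
    ; map-reflect = id
    ; forth       = λ α r → R⊆LRL×GRG F α (Swap⇒R rfl α r)
    ; back-box    = λ α {_} {a} {b} s≤a r → (a , b) , (b , a) , s≤a , swap r , ≤-refl
    ; back-dia    = λ α {_} {a} {b} a≤s r → (a , b) , (b , a) , a≤s , swap r , ≤-refl
    }

proposition18 : (n : ℕ) → SameLog {n} C-ud C-rs × SameLog {n} C-rs C-par
proposition18 n =
  (λ A → InLog-antitone C-rs⊆C-ud A , InLog-reduction ud-from-rs A)
  , (λ A → InLog-antitone C-par⊆C-rs A , InLog-reduction rs-from-par A)
  where
  ud-from-rs : ∀ (F : Frame n) → C-ud F → ∃[ G ] (C-rs G × Reduction G F)
  ud-from-rs F (pre , udr , uds) =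
    RSClosure.frame F , RSClosure.C-rs-frame F pre , RSClosure.reduction F udr uds

  rs-from-par : ∀ (F : Frame n) → C-rs F → ∃[ G ] (C-par G × Reduction G F)
  rs-from-par F F∈rs@(_ , rfl , _) =
    PairFrame.frame F , PairFrame.C-par-frame F F∈rs , PairFrame.reduction F rfl
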